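{- Let $p\ge 3$ be a prime with $p\equiv 1 \pmod 3$, and let $(R,M)$ be a finite commutative local ring whose residue field $R/M$ has characteristic $p$, such that $-1\in (R^{\times})^p$ and $G_R(p)$ is connected. Then the complete graph $K_3$ is an induced subgraph of $G_R(p)$.
   Context: $(R^{\times})^p=\{u^p:u\in R^{\times}\}$. $G_R(p)$ is the simple undirected graph with vertex set $R$ in which $a,b$ are adjacent iff $a-b\in (R^{\times})^p$. $K_3$ being an induced subgraph means there are three vertices that are pairwise adjacent. -}

module Defs where

open import Level using (Level; _⊔_; suc)
open import Data.Nat using (ℕ; _<_)
open import Data.Nat.Primality using (Prime)
open import Data.Product using (Σ; ∃; _×_; _,_)
open import Data.List using (List)
open import Data.List.Relation.Unary.Any using (Any)
open import Relation.Nullary using (¬_)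
open import Relation.Binary using (Decidable)
open import Relation.Unary using (Pred; _∈_; _∉_)
open import Relation.Binary.Construct.Closure.ReflexiveTransitive using (Star)
open import Algebra.Bundles using (CommutativeRing; Semiring)
open import Data.Sum using (_⊎_)
import Algebra.Definitions.RawSemiring as RS

module _ {c ℓ : Level} (R : CommutativeRing c ℓ) where
  open CommutativeRing R
  open RS (Semiring.rawSemiring semiring) using () renaming (_×_ to _·_; _^_ to _^_)

  -- R is finite: there is a list containing every element (up to ≈);
  -- equality is decidable (automatic classically for a finite ring).
  Finite : Set (c ⊔ ℓ)
  Finite = Decidable _≈_ × Σ (List Carrier) (λ xs → ∀ x → Any (x ≈_) xs)

  IsUnit : Pred Carrier (c ⊔ ℓ)
  IsUnit x = ∃ λ y → x * y ≈ 1#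

  PthPowerUnit : ℕ → Pred Carrier (c ⊔ ℓ)
  PthPowerUnit p x = ∃ λ u → IsUnit u × (u ^ p ≈ x)

  record IsIdeal {ℓ′ : Level} (I : Pred Carrier ℓ′) : Set (c ⊔ ℓ ⊔ ℓ′) where
    field
      resp  : ∀ {x y} → x ≈ y → x ∈ I → y ∈ I
      zero∈ : 0# ∈ I
      +-closed : ∀ {x y} → x ∈ I → y ∈ I → (x + y) ∈ I
      *-closed : ∀ r {x} → x ∈ I → (r * x) ∈ I

  -- (R , M) is a local ring with maximal ideal M: M is a proper ideal
  -- and every element outside M is a unit (equivalently, M is the unique
  -- maximal ideal of R).
  record IsLocalWith {ℓ′ : Level} (M : Pred Carrier ℓ′) : Set (c ⊔ ℓ ⊔ ℓ′) where
    field
      ideal  : IsIdeal M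
      proper : 1# ∉ M
      units  : ∀ x → x ∉ M → IsUnit x

  ResidueChar : {ℓ′ : Level} → Pred Carrier ℓ′ → ℕ → Set ℓ′
  ResidueChar M p = ((p · 1#) ∈ M) × (∀ n → 0 < n → n < p → (n · 1#) ∉ M)

  Adj : ℕ → Carrier → Carrier → Set (c ⊔ ℓ)
  Adj p a b = PthPowerUnit p (a - b)

  Connected : ℕ → Set (c ⊔ ℓ)
  Connected p = ∀ a b → Star (λ x y → Adj p x y ⊎ Adj p y x) a b

  HasTriangle : ℕ → Set (c ⊔ ℓ)
  HasTriangle p = ∃ λ a → ∃ λ b → ∃ λ c →
    (¬ a ≈ b) × (¬ b ≈ c) × (¬ a ≈ c) ×
    Adj p a b × Adj p b c × Adj p a c

{-# OPTIONS --safe #-}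
-- Write p = 3m + 1. If ω is a root of Φ₃ = x² + x + 1, then 0, 1 and 1 + ω form a triangle:
-- the differences are 1 = 1ᵖ, ω = ωᵖ (as ω³ = 1) and 1 + ω = -ω² = (u ω²)ᵖ where uᵖ = -1, and
-- p-th powers of units are units, hence nonzero. To find ω: X^m - 1 has at most m < p - 1 roots
-- modulo M, so some 0 < a < p has X = a^m ≢ 1, while X³ = a^(p-1) ≡ 1 by Fermat's little theorem
-- (from the Frobenius congruence); thus Φ₃(X) ∈ M. As Φ₃′(X)² + 3 = 4 Φ₃(X) and 3 ∉ M, Newton's
-- iteration converges M-adically, and M is nil in the finite ring R, so it reaches an exact root.
module Submission where

open import Defs
open import Level using (Level)
open import Data.Nat using (ℕ; _≤_; _%_)
open import Data.Nat.Primality using (Prime)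
open import Relation.Unary using (Pred; _∈_)
open import Relation.Binary.PropositionalEquality using (_≡_)
open import Algebra.Bundles using (CommutativeRing)

open import Data.Nat as ℕ using (zero; suc; _<_; _∸_; _!; _/_; z≤n; s≤s; nonTrivial⇒≢1)
open import Data.Nat.Properties as ℕP using (_!*_!≢0)
open import Data.Nat.Primality using (euclidsLemma; prime⇒nonTrivial; prime⇒nonZero)
open import Data.Nat.Divisibility using (_∣_; divides; ∣1⇒≡1; ∣⇒≤; m∣m*n)
open import Data.Nat.DivMod using (m/n*n≡m; m≡m%n+[m/n]*n)
open import Data.Nat.Combinatorics using (_C_; nCn≡1; nCk≡n!/k![n-k]!; k![n∸k]!∣n!)
open import Data.Integer as ℤ using (ℤ; +_; -[1+_]; _⊖_)
import Data.Integer.Properties as ℤP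
open import Data.Sign as Sign using (Sign)
open import Data.Maybe using (Maybe; just; nothing)
open import Data.Fin as Fin using (Fin; toℕ)
import Data.Fin.Properties as FinP
open import Data.Vec.Functional using (Vector; tail; init; last)
open import Data.List using (List; []; _∷_; length; lookup; replicate; applyUpTo)
open import Data.List.Properties using (length-applyUpTo; length-replicate)
open import Data.List.Relation.Unary.All as All using (All; []; _∷_)
import Data.List.Relation.Unary.All.Properties as AllP
open import Data.List.Relation.Unary.AllPairs using (AllPairs; []; _∷_)
import Data.List.Relation.Unary.AllPairs.Properties as AllPairsP
open import Data.List.Relation.Unary.Any as Any using (Any; index)
open import Data.List.Relation.Unary.Any.Properties using (lookup-index)
open import Data.Product using (∃; ∃₂; _,_; proj₁; proj₂; uncurry)
open import Data.Sum using (inj₁; inj₂)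
open import Function using (_∘_)
open import Relation.Nullary using (¬_; Dec; yes; no; contradiction)
open import Relation.Unary using (_∉_)
import Relation.Binary.PropositionalEquality as ≡
open import Algebra.Solver.Ring.AlmostCommutativeRing
  using (_-Raw-AlmostCommutative⟶_; fromCommutativeRing)
import Algebra.Solver.Ring as RingSolver
import Algebra.Properties.CommutativeSemiring.Binomial as Binomial
import Algebra.Properties.CommutativeSemigroup as CommutativeSemigroupProperties

prime∤n! : ∀ {p n} → Prime p → n < p → ¬ p ∣ n !
prime∤n! {n = zero}  p-prime _   p∣1  = nonTrivial⇒≢1 {{prime⇒nonTrivial p-prime}} (∣1⇒≡1 p∣1)
prime∤n! {n = suc n} p-prime n<p p∣[1+n]! with euclidsLemma (suc n) (n !) p-prime p∣[1+n]!
... | inj₁ p∣1+n = ℕP.<⇒≱ n<p (∣⇒≤ p∣1+n)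
... | inj₂ p∣n!  = prime∤n! p-prime (ℕP.<-trans (ℕP.n<1+n n) n<p) p∣n!

n∣n! : ∀ n .{{_ : ℕ.NonZero n}} → n ∣ n !
n∣n! (suc n) = m∣m*n (n !)

nCk*[k!*[n∸k]!]≡n! : ∀ {n k} → k ≤ n → (n C k) ℕ.* (k ! ℕ.* (n ∸ k) !) ≡ n !
nCk*[k!*[n∸k]!]≡n! {n} {k} k≤n = begin
  (n C k) ℕ.* (k ! ℕ.* (n ∸ k) !)
    ≡⟨ ≡.cong (ℕ._* (k ! ℕ.* (n ∸ k) !)) (nCk≡n!/k![n-k]! k≤n) ⟩
  (n ! / (k ! ℕ.* (n ∸ k) !)) ℕ.* (k ! ℕ.* (n ∸ k) !)
    ≡⟨ m/n*n≡m (k![n∸k]!∣n! k≤n) ⟩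
  n ! ∎
  where
  open ≡.≡-Reasoning
  instance
    k!*[n∸k]!≢0 : ℕ.NonZero (k ! ℕ.* (n ∸ k) !)
    k!*[n∸k]!≢0 = k !* (n ∸ k) !≢0

p∣pCk : ∀ {p k} → Prime p → 0 < k → k < p → p ∣ p C k
p∣pCk {p} {k} p-prime 0<k k<p
  with euclidsLemma (p C k) (k ! ℕ.* (p ∸ k) !) p-prime
         (≡.subst (p ∣_) (≡.sym (nCk*[k!*[n∸k]!]≡n! (ℕP.<⇒≤ k<p)))
                  (n∣n! p {{prime⇒nonZero p-prime}}))
... | inj₁ p∣pCk = p∣pCk
... | inj₂ p∣k!*[p∸k]! with euclidsLemma (k !) ((p ∸ k) !) p-prime p∣k!*[p∸k]!
...   | inj₁ p∣k!     = contradiction p∣k! (prime∤n! p-prime k<p)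
...   | inj₂ p∣[p∸k]! =
  contradiction p∣[p∸k]! (prime∤n! p-prime (ℕP.∸-monoʳ-< 0<k (ℕP.<⇒≤ k<p)))

%3≡1⇒≡1+[1+n]*3 : ∀ {p} → 3 ≤ p → p % 3 ≡ 1 → ∃ λ n → p ≡ suc (suc n ℕ.* 3)
%3≡1⇒≡1+[1+n]*3 {p} 3≤p p%3≡1 with p / 3 | m≡m%n+[m/n]*n p 3
... | zero  | p≡p%3+0   =
  contradiction (≡.subst (3 ≤_) (≡.trans p≡p%3+0 (≡.cong (ℕ._+ 0) p%3≡1)) 3≤p) λ { (s≤s ()) }
... | suc n | p≡p%3+q*3 = n , ≡.trans p≡p%3+q*3 (≡.cong (ℕ._+ suc n ℕ.* 3) p%3≡1)

-- The library instantiates its ring solver only with natural-number coefficients, which cannot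
-- express negation; this instantiates it with integer coefficients. The optimised _×_ makes the
-- constant con (+ 1) evaluate to 1# definitionally.
module IntegerCoefficients {c ℓ} (R : CommutativeRing c ℓ) where
  open CommutativeRing R
  open import Algebra.Properties.Ring ring
    using (-0#≈0#; -‿involutive; -‿distribˡ-*; -‿distribʳ-*; -‿+-comm)
  open import Algebra.Properties.CommutativeSemigroup +-commutativeSemigroup using (interchange)
  open import Algebra.Properties.Semiring.Mult.TCOptimised semiring
    using (_×_; ×-homo-+; ×1-homo-*; 1+×)
  open import Relation.Binary.Reasoning.Setoid setoid

  fromℤ : ℤ → Carrier
  fromℤ (+ n)    = n × 1#
  fromℤ -[1+ n ] = - (suc n × 1#)

  fromℤ-neg : ∀ i → fromℤ (ℤ.- i) ≈ - fromℤ i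
  fromℤ-neg (+ zero)  = sym -0#≈0#
  fromℤ-neg (+ suc n) = refl
  fromℤ-neg -[1+ n ]  = sym (-‿involutive _)

  fromℤ-⊖ : ∀ m n → fromℤ (m ⊖ n) ≈ m × 1# - n × 1#
  fromℤ-⊖ m       zero    = sym (trans (+-congˡ -0#≈0#) (+-identityʳ _))
  fromℤ-⊖ zero    (suc n) = sym (+-identityˡ _)
  fromℤ-⊖ (suc m) (suc n) = begin
    fromℤ (suc m ⊖ suc n)                 ≡⟨ ≡.cong fromℤ (ℤP.[1+m]⊖[1+n]≡m⊖n m n) ⟩
    fromℤ (m ⊖ n)                         ≈⟨ fromℤ-⊖ m n ⟩
    m × 1# - n × 1#                       ≈⟨ +-identityˡ _ ⟨
    0# + (m × 1# - n × 1#)                ≈⟨ +-congʳ (-‿inverseʳ 1#) ⟨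
    (1# - 1#) + (m × 1# - n × 1#)         ≈⟨ interchange 1# (- 1#) (m × 1#) (- (n × 1#)) ⟩
    (1# + m × 1#) + (- 1# - n × 1#)       ≈⟨ +-congˡ (-‿+-comm 1# (n × 1#)) ⟩
    (1# + m × 1#) - (1# + n × 1#)         ≈⟨ +-cong (1+× m 1#) (-‿cong (1+× n 1#)) ⟨
    suc m × 1# - suc n × 1#               ∎

  fromℤ-+ : ∀ i j → fromℤ (i ℤ.+ j) ≈ fromℤ i + fromℤ j
  fromℤ-+ (+ m)    (+ n)    = ×-homo-+ 1# m n
  fromℤ-+ (+ m)    -[1+ n ] = fromℤ-⊖ m (suc n)
  fromℤ-+ -[1+ m ] (+ n)    = trans (fromℤ-⊖ n (suc m)) (+-comm _ _)
  fromℤ-+ -[1+ m ] -[1+ n ] = begin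
    - (suc (suc (m ℕ.+ n)) × 1#)          ≡⟨ ≡.cong (λ k → - (k × 1#)) (ℕP.+-suc (suc m) n) ⟨
    - ((suc m ℕ.+ suc n) × 1#)            ≈⟨ -‿cong (×-homo-+ 1# (suc m) (suc n)) ⟩
    - (suc m × 1# + suc n × 1#)           ≈⟨ -‿+-comm _ _ ⟨
    - (suc m × 1#) - suc n × 1#           ∎

  signed : Sign → Carrier → Carrier
  signed Sign.+ x = x
  signed Sign.- x = - x

  signed-cong : ∀ s {x y} → x ≈ y → signed s x ≈ signed s y
  signed-cong Sign.+ x≈y = x≈y
  signed-cong Sign.- x≈y = -‿cong x≈y

  signed-* : ∀ s t x y → signed (s Sign.* t) (x * y) ≈ signed s x * signed t y
  signed-* Sign.+ Sign.+ x y = refl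
  signed-* Sign.+ Sign.- x y = -‿distribʳ-* x y
  signed-* Sign.- Sign.+ x y = -‿distribˡ-* x y
  signed-* Sign.- Sign.- x y = begin
    x * y         ≈⟨ -‿involutive _ ⟨
    - - (x * y)   ≈⟨ -‿cong (-‿distribʳ-* x y) ⟩
    - (x * - y)   ≈⟨ -‿distribˡ-* x (- y) ⟩
    - x * - y     ∎

  fromℤ-◃ : ∀ s n → fromℤ (s ℤ.◃ n) ≈ signed s (n × 1#)
  fromℤ-◃ Sign.+ zero    = refl
  fromℤ-◃ Sign.- zero    = sym -0#≈0#
  fromℤ-◃ Sign.+ (suc n) = refl
  fromℤ-◃ Sign.- (suc n) = refl

  fromℤ-signed : ∀ i → fromℤ i ≈ signed (ℤ.sign i) (ℤ.∣ i ∣ × 1#)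
  fromℤ-signed (+ n)    = refl
  fromℤ-signed -[1+ n ] = refl

  fromℤ-* : ∀ i j → fromℤ (i ℤ.* j) ≈ fromℤ i * fromℤ j
  fromℤ-* i j = begin
    fromℤ (i ℤ.* j)
      ≈⟨ fromℤ-◃ (s Sign.* t) (ℤ.∣ i ∣ ℕ.* ℤ.∣ j ∣) ⟩
    signed (s Sign.* t) ((ℤ.∣ i ∣ ℕ.* ℤ.∣ j ∣) × 1#)
      ≈⟨ signed-cong (s Sign.* t) (×1-homo-* ℤ.∣ i ∣ ℤ.∣ j ∣) ⟩
    signed (s Sign.* t) ((ℤ.∣ i ∣ × 1#) * (ℤ.∣ j ∣ × 1#))
      ≈⟨ signed-* s t _ _ ⟩
    signed s (ℤ.∣ i ∣ × 1#) * signed t (ℤ.∣ j ∣ × 1#)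
      ≈⟨ *-cong (fromℤ-signed i) (fromℤ-signed j) ⟨
    fromℤ i * fromℤ j
      ∎
    where
    s t : Sign
    s = ℤ.sign i
    t = ℤ.sign j

  fromℤ-homomorphism : ℤ.+-*-rawRing -Raw-AlmostCommutative⟶ fromCommutativeRing R
  fromℤ-homomorphism = record
    { ⟦_⟧ = fromℤ ; +-homo = fromℤ-+ ; *-homo = fromℤ-* ; -‿homo = fromℤ-neg
    ; 0-homo = refl ; 1-homo = refl }

  fromℤ-≟ : ∀ i j → Maybe (fromℤ i ≈ fromℤ j)
  fromℤ-≟ i j with i ℤ.≟ j
  ... | yes ≡.refl = just refl
  ... | no _       = nothing

  open RingSolver ℤ.+-*-rawRing (fromCommutativeRing R) fromℤ-homomorphism fromℤ-≟ public

module _ {c ℓ : Level} (R : CommutativeRing c ℓ) where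
  open CommutativeRing R
  open import Algebra.Properties.Ring ring using (-0#≈0#; -1*x≈-x)
  open import Algebra.Properties.Semiring.Mult semiring
    using (_×_; ×-homo-+; ×-assocˡ; ×-assoc-*; ×-congʳ)
  open import Algebra.Properties.Semiring.Mult.TCOptimised semiring
    using (×ᵤ≈×) renaming (_×_ to _×′_)
  open import Algebra.Properties.Semiring.Exp semiring using (_^_; ^-congˡ; ^-homo-*; ^-assocʳ)
  open import Algebra.Properties.CommutativeSemiring.Exp commutativeSemiring using (^-distrib-*)
  open import Algebra.Properties.Semiring.Sum semiring using (sum; sum-init-last)
  open CommutativeSemigroupProperties *-commutativeSemigroup
    using () renaming (interchange to *-interchange)
  open import Relation.Binary.Reasoning.Setoid setoid
  open IntegerCoefficients R
    using (Polynomial; solve; _:=_; _:+_; _:*_; _:-_; :-_; _:^_; con)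

  1#^n≈1# : ∀ n → 1# ^ n ≈ 1#
  1#^n≈1# zero    = refl
  1#^n≈1# (suc n) = trans (*-identityˡ _) (1#^n≈1# n)

  x^3≈1⇒x^[1+m*3]≈x : ∀ {x} → x ^ 3 ≈ 1# → ∀ m → x ^ suc (m ℕ.* 3) ≈ x
  x^3≈1⇒x^[1+m*3]≈x {x} x³≈1 m = begin
    x * x ^ (m ℕ.* 3)   ≡⟨ ≡.cong (λ k → x * x ^ k) (ℕP.*-comm m 3) ⟩
    x * x ^ (3 ℕ.* m)   ≈⟨ *-congˡ (^-assocʳ x 3 m) ⟨
    x * (x ^ 3) ^ m     ≈⟨ *-congˡ (trans (^-congˡ m x³≈1) (1#^n≈1# m)) ⟩
    x * 1#              ≈⟨ *-identityʳ x ⟩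
    x                   ∎

  isUnit-* : ∀ {x y} → IsUnit R x → IsUnit R y → IsUnit R (x * y)
  isUnit-* {x} {y} (x⁻¹ , xx⁻¹≈1) (y⁻¹ , yy⁻¹≈1) = x⁻¹ * y⁻¹ , (begin
    (x * y) * (x⁻¹ * y⁻¹)    ≈⟨ *-interchange x y x⁻¹ y⁻¹ ⟩
    (x * x⁻¹) * (y * y⁻¹)    ≈⟨ *-cong xx⁻¹≈1 yy⁻¹≈1 ⟩
    1# * 1#                  ≈⟨ *-identityˡ 1# ⟩
    1#                       ∎)

  x*u≈0⇒x≈0 : ∀ {x u} → IsUnit R u → x * u ≈ 0# → x ≈ 0#
  x*u≈0⇒x≈0 {x} {u} (u⁻¹ , uu⁻¹≈1) xu≈0 = begin
    x               ≈⟨ *-identityʳ x ⟨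
    x * 1#          ≈⟨ *-congˡ uu⁻¹≈1 ⟨
    x * (u * u⁻¹)   ≈⟨ *-assoc x u u⁻¹ ⟨
    (x * u) * u⁻¹   ≈⟨ *-congʳ xu≈0 ⟩
    0# * u⁻¹        ≈⟨ zeroˡ u⁻¹ ⟩
    0#              ∎

  pthPowerUnit-resp : ∀ {p x y} → x ≈ y → PthPowerUnit R p x → PthPowerUnit R p y
  pthPowerUnit-resp x≈y (u , u-unit , uᵖ≈x) = u , u-unit , trans uᵖ≈x x≈y

  pthPowerUnit-* : ∀ {p x y} → PthPowerUnit R p x → PthPowerUnit R p y → PthPowerUnit R p (x * y)
  pthPowerUnit-* {p} (u , u-unit , uᵖ≈x) (v , v-unit , vᵖ≈y) =
    u * v , isUnit-* u-unit v-unit , trans (^-distrib-* u v p) (*-cong uᵖ≈x vᵖ≈y)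

  pthPowerUnit-1# : ∀ p → PthPowerUnit R p 1#
  pthPowerUnit-1# p = 1# , (1# , *-identityˡ 1#) , 1#^n≈1# p

  pthPowerUnit⇒≉0 : ¬ 1# ≈ 0# → ∀ {p x} → PthPowerUnit R p x → ¬ x ≈ 0#
  pthPowerUnit⇒≉0 1≉0 {p} (u , (u⁻¹ , uu⁻¹≈1) , uᵖ≈x) x≈0 =
    1≉0 (begin
      1#                 ≈⟨ 1#^n≈1# p ⟨
      1# ^ p             ≈⟨ ^-congˡ p uu⁻¹≈1 ⟨
      (u * u⁻¹) ^ p      ≈⟨ ^-distrib-* u u⁻¹ p ⟩
      u ^ p * u⁻¹ ^ p    ≈⟨ *-congʳ (trans uᵖ≈x x≈0) ⟩
      0# * u⁻¹ ^ p       ≈⟨ zeroˡ _ ⟩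
      0#                 ∎)

  adjacent⇒≉ : ¬ 1# ≈ 0# → ∀ {p a b} → Adj R p a b → ¬ a ≈ b
  adjacent⇒≉ 1≉0 {p} a~b a≈b = pthPowerUnit⇒≉0 1≉0 {p} a~b (trans (+-congʳ a≈b) (-‿inverseʳ _))

  Φ₃ : Carrier → Carrier
  Φ₃ x = x * x + x + 1#

  :Φ₃ : ∀ {n} → Polynomial n → Polynomial n
  :Φ₃ x = x :* x :+ x :+ con (+ 1)

  Φ₃-cong : ∀ {x y} → x ≈ y → Φ₃ x ≈ Φ₃ y
  Φ₃-cong x≈y = +-congʳ (+-cong (*-cong x≈y x≈y) x≈y)

  x^3-1≈Φ₃[x]*[x-1] : ∀ x → x ^ 3 - 1# ≈ Φ₃ x * (x - 1#)
  x^3-1≈Φ₃[x]*[x-1] = solve 1 (λ x → x :^ 3 :- con (+ 1) := :Φ₃ x :* (x :- con (+ 1))) refl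

  x^3≈Φ₃[x]*[x-1]+1 : ∀ x → x ^ 3 ≈ Φ₃ x * (x - 1#) + 1#
  x^3≈Φ₃[x]*[x-1]+1 = solve 1 (λ x → x :^ 3 := :Φ₃ x :* (x :- con (+ 1)) :+ con (+ 1)) refl

  Φ₃-root⇒x^3≈1 : ∀ {ω} → Φ₃ ω ≈ 0# → ω ^ 3 ≈ 1#
  Φ₃-root⇒x^3≈1 {ω} Φ₃ω≈0 = begin
    ω ^ 3                  ≈⟨ x^3≈Φ₃[x]*[x-1]+1 ω ⟩
    Φ₃ ω * (ω - 1#) + 1#   ≈⟨ +-congʳ (trans (*-congʳ Φ₃ω≈0) (zeroˡ _)) ⟩
    0# + 1#                ≈⟨ +-identityˡ 1# ⟩
    1#                     ∎

  triangle-from-Φ₃-root : ¬ 1# ≈ 0# → ∀ {m ω} →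
                          PthPowerUnit R (suc (m ℕ.* 3)) (- 1#) → Φ₃ ω ≈ 0# →
                          HasTriangle R (suc (m ℕ.* 3))
  triangle-from-Φ₃-root 1≉0 {m} {ω} -1-power Φ₃ω≈0 =
    1# + ω , 1# , 0# ,
    adjacent⇒≉ 1≉0 {p} [1+ω]~1 , adjacent⇒≉ 1≉0 {p} 1~0 , adjacent⇒≉ 1≉0 {p} [1+ω]~0 ,
    [1+ω]~1 , 1~0 , [1+ω]~0
    where
    p : ℕ
    p = suc (m ℕ.* 3)

    ω³≈1 : ω ^ 3 ≈ 1#
    ω³≈1 = Φ₃-root⇒x^3≈1 Φ₃ω≈0

    ω-power : PthPowerUnit R p ω
    ω-power = ω , (ω * ω , trans (*-congˡ (*-congˡ (sym (*-identityʳ ω)))) ω³≈1) ,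
              x^3≈1⇒x^[1+m*3]≈x ω³≈1 m

    [1+ω]~1 : Adj R p (1# + ω) 1#
    [1+ω]~1 = pthPowerUnit-resp {p} (solve 1 (λ x → x := con (+ 1) :+ x :- con (+ 1)) refl ω)
                                ω-power

    1~0 : Adj R p 1# 0#
    1~0 = pthPowerUnit-resp {p} (solve 0 (con (+ 1) := con (+ 1) :- con (+ 0)) refl)
                            (pthPowerUnit-1# p)

    [1+ω]~0 : Adj R p (1# + ω) 0#
    [1+ω]~0 = pthPowerUnit-resp {p} -ω²≈1+ω
                (pthPowerUnit-* {p} -1-power (pthPowerUnit-* {p} ω-power ω-power))
      where
      -ω²≈1+ω : - 1# * (ω * ω) ≈ 1# + ω - 0#
      -ω²≈1+ω = begin
        - 1# * (ω * ω)
          ≈⟨ solve 1 (λ x → :- con (+ 1) :* (x :* x) := con (+ 1) :+ x :- con (+ 0) :- :Φ₃ x) refl ω ⟩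
        1# + ω - 0# - Φ₃ ω            ≈⟨ +-congˡ (trans (-‿cong Φ₃ω≈0) -0#≈0#) ⟩
        1# + ω - 0# + 0#              ≈⟨ +-identityʳ _ ⟩
        1# + ω - 0#                   ∎

  module IdealProperties {ℓ′} {I : Pred Carrier ℓ′} (isIdeal : IsIdeal R I) where
    open IsIdeal isIdeal public

    *-closedʳ : ∀ {x} r → x ∈ I → (x * r) ∈ I
    *-closedʳ r x∈I = resp (*-comm r _) (*-closed r x∈I)

    -‿closed : ∀ {x} → x ∈ I → (- x) ∈ I
    -‿closed {x} x∈I = resp (-1*x≈-x x) (*-closed (- 1#) x∈I)

    sub-closed : ∀ {x y} → x ∈ I → y ∈ I → (x - y) ∈ I
    sub-closed x∈I y∈I = +-closed x∈I (-‿closed y∈I)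

    +-cancelˡ : ∀ {x y} → x ∈ I → (x + y) ∈ I → y ∈ I
    +-cancelˡ {x} {y} x∈I x+y∈I =
      resp (solve 2 (λ x y → (x :+ y) :- x := y) refl x y) (sub-closed x+y∈I x∈I)

    ×-closed : ∀ n {x} → x ∈ I → (n × x) ∈ I
    ×-closed zero    x∈I = zero∈
    ×-closed (suc n) x∈I = +-closed x∈I (×-closed n x∈I)

    sum-closed : ∀ {n} (t : Vector Carrier n) → (∀ i → t i ∈ I) → sum t ∈ I
    sum-closed {zero}  t t∈I = zero∈
    sum-closed {suc n} t t∈I = +-closed (t∈I Fin.zero) (sum-closed (tail t) (t∈I ∘ Fin.suc))

  module Frobenius {ℓ′} {I : Pred Carrier ℓ′} (isIdeal : IsIdeal R I)
                   {k : ℕ} (p-prime : Prime (suc k)) (p∈I : (suc k × 1#) ∈ I) where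
    open IdealProperties isIdeal

    p : ℕ
    p = suc k

    p∣n⇒n×x∈I : ∀ {n} x → p ∣ n → (n × x) ∈ I
    p∣n⇒n×x∈I x (divides q ≡.refl) = resp q×[p×1*x]≈[q*p]×x (×-closed q (*-closedʳ x p∈I))
      where
      q×[p×1*x]≈[q*p]×x : q × ((p × 1#) * x) ≈ (q ℕ.* p) × x
      q×[p×1*x]≈[q*p]×x = begin
        q × ((p × 1#) * x)   ≈⟨ ×-congʳ q (×-assoc-* p 1# x) ⟩
        q × (p × (1# * x))   ≈⟨ ×-congʳ q (×-congʳ p (*-identityˡ x)) ⟩
        q × (p × x)          ≈⟨ ×-assocˡ x q p ⟩
        (q ℕ.* p) × x        ∎

    frobenius : ∀ x → ((x + 1#) ^ p - (x ^ p + 1#)) ∈ I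
    frobenius x = resp (sym [x+1]^p-[x^p+1]≈S) (sum-closed middle middle∈I)
      where
      open Binomial commutativeSemiring using (theorem; binomialTerm)

      t : Vector Carrier (suc p)
      t = binomialTerm x 1# p

      middle : Vector Carrier k
      middle = init (tail t)

      middle∈I : ∀ i → middle i ∈ I
      middle∈I i = p∣n⇒n×x∈I _ (p∣pCk p-prime (s≤s z≤n) (s≤s i<k))
        where
        i<k : toℕ (Fin.inject₁ i) < k
        i<k = ≡.subst (_< k) (≡.sym (FinP.toℕ-inject₁ i)) (FinP.toℕ<n i)

      first≈1 : t Fin.zero ≈ 1#
      first≈1 = begin
        (p C 0) × (1# * 1# ^ p)   ≈⟨ +-identityʳ _ ⟩
        1# * 1# ^ p               ≈⟨ *-identityˡ _ ⟩
        1# ^ p                    ≈⟨ 1#^n≈1# p ⟩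
        1#                        ∎

      last≈x^p : ∀ j → j ≡ p → (p C j) × (x ^ j * 1# ^ (p ∸ j)) ≈ x ^ p
      last≈x^p .p ≡.refl = begin
        (p C p) × (x ^ p * 1# ^ (p ∸ p))   ≡⟨ ≡.cong (_× (x ^ p * 1# ^ (p ∸ p))) (nCn≡1 p) ⟩
        1 × (x ^ p * 1# ^ (p ∸ p))         ≈⟨ +-identityʳ _ ⟩
        x ^ p * 1# ^ (p ∸ p)               ≈⟨ *-congˡ (1#^n≈1# (p ∸ p)) ⟩
        x ^ p * 1#                         ≈⟨ *-identityʳ _ ⟩
        x ^ p                              ∎

      [x+1]^p-[x^p+1]≈S : (x + 1#) ^ p - (x ^ p + 1#) ≈ sum middle
      [x+1]^p-[x^p+1]≈S = begin
        (x + 1#) ^ p - (x ^ p + 1#)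
          ≈⟨ +-congʳ (theorem p x 1#) ⟩
        t Fin.zero + sum (tail t) - (x ^ p + 1#)
          ≈⟨ +-congʳ (+-cong first≈1 (sum-init-last (tail t))) ⟩
        1# + (sum middle + last (tail t)) - (x ^ p + 1#)
          ≈⟨ +-congʳ (+-congˡ (+-congˡ (last≈x^p _ (≡.cong suc (FinP.toℕ-fromℕ k))))) ⟩
        1# + (sum middle + x ^ p) - (x ^ p + 1#)
          ≈⟨ solve 2 (λ S X → con (+ 1) :+ (S :+ X) :- (X :+ con (+ 1)) := S) refl
                   (sum middle) (x ^ p) ⟩
        sum middle
          ∎

    fermat : ∀ a → ((a × 1#) ^ p - a × 1#) ∈ I
    fermat zero    = resp (sym (trans (+-cong (zeroˡ _) -0#≈0#) (+-identityʳ 0#))) zero∈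
    fermat (suc a) = resp step (+-closed (frobenius A) (fermat a))
      where
      A : Carrier
      A = a × 1#

      step : ((A + 1#) ^ p - (A ^ p + 1#)) + (A ^ p - A) ≈ (1# + A) ^ p - (1# + A)
      step = begin
        ((A + 1#) ^ p - (A ^ p + 1#)) + (A ^ p - A)
          ≈⟨ solve 3 (λ B X A → (B :- (X :+ con (+ 1))) :+ (X :- A) := B :- (con (+ 1) :+ A)) refl
                   ((A + 1#) ^ p) (A ^ p) A ⟩
        (A + 1#) ^ p - (1# + A)    ≈⟨ +-congʳ (^-congˡ p (+-comm A 1#)) ⟩
        (1# + A) ^ p - (1# + A)    ∎

  -- evalMonic (c₀ ∷ … ∷ c_(d-1)) evaluates the monic polynomial c₀ + c₁x + … + c_(d-1)x^(d-1) + x^d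
  -- of degree d by Horner's rule.
  evalMonic : List Carrier → Carrier → Carrier
  evalMonic []       x = 1#
  evalMonic (c ∷ cs) x = c + x * evalMonic cs x

  deflate : Carrier → List Carrier → List Carrier
  deflate r []            = []
  deflate r (c ∷ [])      = []
  deflate r (c ∷ c′ ∷ cs) = evalMonic (c′ ∷ cs) r ∷ deflate r (c′ ∷ cs)

  length-deflate : ∀ r c cs → length (deflate r (c ∷ cs)) ≡ length cs
  length-deflate r c []        = ≡.refl
  length-deflate r c (c′ ∷ cs) = ≡.cong suc (length-deflate r c′ cs)

  evalMonic-deflate : ∀ r c cs x →
    evalMonic (c ∷ cs) x ≈ evalMonic (c ∷ cs) r + (x - r) * evalMonic (deflate r (c ∷ cs)) x
  evalMonic-deflate r c [] x =
    solve 3 (λ c r x → c :+ x :* con (+ 1) := (c :+ r :* con (+ 1)) :+ (x :- r) :* con (+ 1))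
            refl c r x
  evalMonic-deflate r c (c′ ∷ cs) x = begin
    c + x * P′[x]
      ≈⟨ +-congˡ (*-congˡ (evalMonic-deflate r c′ cs x)) ⟩
    c + x * (P′[r] + (x - r) * Q′[x])
      ≈⟨ solve 5 (λ c x r A B → c :+ x :* (A :+ (x :- r) :* B)
                               := (c :+ r :* A) :+ (x :- r) :* (A :+ x :* B))
               refl c x r P′[r] Q′[x] ⟩
    (c + r * P′[r]) + (x - r) * (P′[r] + x * Q′[x])
      ∎
    where
    P′[x] P′[r] Q′[x] : Carrier
    P′[x] = evalMonic (c′ ∷ cs) x
    P′[r] = evalMonic (c′ ∷ cs) r
    Q′[x] = evalMonic (deflate r (c′ ∷ cs)) x

  evalMonic-X^[1+n]-1 : ∀ n x → evalMonic (- 1# ∷ replicate n 0#) x ≈ x ^ suc n - 1#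
  evalMonic-X^[1+n]-1 n x = trans (+-congˡ (*-congˡ (evalMonic-0#s n))) (+-comm _ _)
    where
    evalMonic-0#s : ∀ n → evalMonic (replicate n 0#) x ≈ x ^ n
    evalMonic-0#s zero    = refl
    evalMonic-0#s (suc n) = trans (+-identityˡ _) (*-congˡ (evalMonic-0#s n))

  module _ (finite : Finite R) where

    elements : List Carrier
    elements = proj₁ (proj₂ finite)

    complete : ∀ x → Any (x ≈_) elements
    complete = proj₂ (proj₂ finite)

    exists? : ∀ {q} {P : Pred Carrier q} → (∀ {x y} → x ≈ y → P x → P y) → (∀ x → Dec (P x)) →
              Dec (∃ P)
    exists? resp-P P? with Any.any? P? elements
    ... | yes P-element = yes (Any.satisfied P-element)
    ... | no ¬P-element =
      no λ (x , Px) → ¬P-element (Any.map (λ x≈y → resp-P x≈y Px) (complete x))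

    powers-repeat : ∀ x → ∃₂ λ i d → x ^ i ≈ x ^ (i ℕ.+ suc d)
    powers-repeat x
      with FinP.pigeonhole (ℕP.n<1+n (length elements)) (index ∘ complete ∘ (x ^_) ∘ toℕ)
    ... | i , j , i<j , same-index = toℕ i , toℕ j ∸ suc (toℕ i) , (begin
      x ^ toℕ i                                        ≈⟨ lookup-index (complete (x ^ toℕ i)) ⟩
      lookup elements (index (complete (x ^ toℕ i)))   ≡⟨ ≡.cong (lookup elements) same-index ⟩
      lookup elements (index (complete (x ^ toℕ j)))   ≈⟨ lookup-index (complete (x ^ toℕ j)) ⟨
      x ^ toℕ j                                        ≡⟨ ≡.cong (x ^_) j≡i+[1+d] ⟨
      x ^ (toℕ i ℕ.+ suc (toℕ j ∸ suc (toℕ i)))        ∎)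
      where
      j≡i+[1+d] : toℕ i ℕ.+ suc (toℕ j ∸ suc (toℕ i)) ≡ toℕ j
      j≡i+[1+d] = ≡.trans (ℕP.+-suc (toℕ i) (toℕ j ∸ suc (toℕ i))) (ℕP.m+[n∸m]≡n i<j)

  module LocalRing {ℓ′} {M : Pred Carrier ℓ′} (isLocal : IsLocalWith R M) where
    open IsLocalWith isLocal
    open IdealProperties ideal

    1#≉0# : ¬ 1# ≈ 0#
    1#≉0# 1≈0 = proper (resp (sym 1≈0) zero∈)

    ∉⇒*-cancelˡ : ∀ {x y} → x ∉ M → (x * y) ∈ M → y ∈ M
    ∉⇒*-cancelˡ {x} {y} x∉M xy∈M = resp x⁻¹[xy]≈y (*-closed x⁻¹ xy∈M)
      where
      x⁻¹ : Carrier
      x⁻¹ = proj₁ (units x x∉M)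

      x⁻¹[xy]≈y : x⁻¹ * (x * y) ≈ y
      x⁻¹[xy]≈y = begin
        x⁻¹ * (x * y)   ≈⟨ *-assoc x⁻¹ x y ⟨
        (x⁻¹ * x) * y   ≈⟨ *-congʳ (trans (*-comm x⁻¹ x) (proj₂ (units x x∉M))) ⟩
        1# * y          ≈⟨ *-identityˡ y ⟩
        y               ∎

    1-∈⇒∉ : ∀ {x} → x ∈ M → (1# - x) ∉ M
    1-∈⇒∉ {x} x∈M 1-x∈M =
      proper (resp (solve 2 (λ y x → y :- x :+ x := y) refl 1# x) (+-closed 1-x∈M x∈M))

    ∈⇒nilpotent : Finite R → ∀ {x} → x ∈ M → ∃ λ n → x ^ n ≈ 0#
    ∈⇒nilpotent finite {x} x∈M with powers-repeat finite x
    ... | i , d , xⁱ≈xⁱ⁺ᵈ⁺¹ = i , x*u≈0⇒x≈0 (units _ (1-∈⇒∉ xᵈ⁺¹∈M)) (begin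
      x ^ i * (1# - x ^ suc d)
        ≈⟨ solve 2 (λ y z → y :* (con (+ 1) :- z) := y :- y :* z) refl (x ^ i) (x ^ suc d) ⟩
      x ^ i - x ^ i * x ^ suc d
        ≈⟨ +-congˡ (-‿cong (trans (sym (^-homo-* x i (suc d))) (sym xⁱ≈xⁱ⁺ᵈ⁺¹))) ⟩
      x ^ i - x ^ i
        ≈⟨ -‿inverseʳ _ ⟩
      0# ∎)
      where
      xᵈ⁺¹∈M : x ^ suc d ∈ M
      xᵈ⁺¹∈M = *-closedʳ (x ^ d) x∈M

    monic-roots-bound : ∀ cs {rs} → AllPairs (λ r s → (s - r) ∉ M) rs →
                        All (λ r → evalMonic cs r ∈ M) rs → length rs ≤ length cs
    monic-roots-bound cs       {[]}     _ _ = z≤n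
    monic-roots-bound []       {r ∷ rs} _ (1∈M ∷ _) = contradiction 1∈M proper
    monic-roots-bound (c ∷ cs) {r ∷ rs} (r-apart ∷ rs-apart) (P[r]∈M ∷ P[rs]∈M) =
      s≤s (≡.subst (length rs ≤_) (length-deflate r c cs)
                   (monic-roots-bound (deflate r (c ∷ cs)) rs-apart
                                      (All.zipWith (uncurry Q[s]∈M) (r-apart , P[rs]∈M))))
      where
      Q[s]∈M : ∀ {s} → (s - r) ∉ M → evalMonic (c ∷ cs) s ∈ M →
               evalMonic (deflate r (c ∷ cs)) s ∈ M
      Q[s]∈M {s} s-r∉M P[s]∈M =
        ∉⇒*-cancelˡ s-r∉M (+-cancelˡ P[r]∈M (resp (evalMonic-deflate r c cs s) P[s]∈M))

    module _ {p} (char : ResidueChar R M p) where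

      ×1#-apart : ∀ {i j} → i < j → j < p → (j × 1#) - (i × 1#) ∉ M
      ×1#-apart {i} {j} i<j j<p =
        proj₂ char (j ∸ i) (ℕP.m<n⇒0<n∸m i<j) (ℕP.≤-<-trans (ℕP.m∸n≤m j i) j<p) ∘ resp j-i≈[j∸i]
        where
        j-i≈[j∸i] : (j × 1#) - (i × 1#) ≈ (j ∸ i) × 1#
        j-i≈[j∸i] = begin
          j × 1# - i × 1#
            ≡⟨ ≡.cong (λ n → n × 1# - i × 1#) (ℕP.m+[n∸m]≡n (ℕP.<⇒≤ i<j)) ⟨
          (i ℕ.+ (j ∸ i)) × 1# - i × 1#
            ≈⟨ +-congʳ (×-homo-+ 1# i (j ∸ i)) ⟩
          i × 1# + (j ∸ i) × 1# - i × 1#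
            ≈⟨ solve 2 (λ a b → a :+ b :- a := b) refl (i × 1#) ((j ∸ i) × 1#) ⟩
          (j ∸ i) × 1# ∎

      ¬all-roots-of-X^[1+n]-1 : ∀ {n k} → k < p → suc n < k →
                                ¬ (∀ a → a < k → ((suc a × 1#) ^ suc n - 1#) ∈ M)
      ¬all-roots-of-X^[1+n]-1 {n} {k} k<p 1+n<k all-roots =
        ℕP.<⇒≱ 1+n<k (≡.subst₂ _≤_ (length-applyUpTo [1+_]×1# k) (≡.cong suc (length-replicate n))
                                  roots-bound)
        where
        [1+_]×1# : ℕ → Carrier
        [1+ a ]×1# = suc a × 1#

        roots-bound : length (applyUpTo [1+_]×1# k) ≤ length (- 1# ∷ replicate n 0#)
        roots-bound = monic-roots-bound (- 1# ∷ replicate n 0#)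
          (AllPairsP.applyUpTo⁺₁ [1+_]×1# k λ i<j j<k → ×1#-apart (s≤s i<j) (ℕP.≤-<-trans j<k k<p))
          (AllP.applyUpTo⁺₁ [1+_]×1# k λ {a} a<k →
             resp (sym (evalMonic-X^[1+n]-1 n _)) (all-roots a a<k))

    module _ (3∉M : 3 × 1# ∉ M) where

      Φ₃-newton-step : ∀ {y} → Φ₃ y ∈ M → ∃ λ v → Φ₃ (y - Φ₃ y * v) ≈ (Φ₃ y * v) * (Φ₃ y * v)
      Φ₃-newton-step {y} Φ₃y∈M = v , (begin
        Φ₃ (y - F * v)                         ≈⟨ newton-identity y v ⟩
        F * (1# - D * v) + (F * v) * (F * v)
          ≈⟨ +-congʳ (*-congˡ (trans (+-congˡ (-‿cong Dv≈1)) (-‿inverseʳ 1#))) ⟩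
        F * 0# + (F * v) * (F * v)             ≈⟨ +-congʳ (zeroʳ F) ⟩
        0# + (F * v) * (F * v)                 ≈⟨ +-identityˡ _ ⟩
        (F * v) * (F * v)                      ∎)
        where
        F D : Carrier
        F = Φ₃ y
        D = y + y + 1#

        newton-identity : ∀ y v →
          Φ₃ (y - Φ₃ y * v) ≈ Φ₃ y * (1# - (y + y + 1#) * v) + (Φ₃ y * v) * (Φ₃ y * v)
        newton-identity = solve 2 (λ y v → :Φ₃ (y :- :Φ₃ y :* v)
          := :Φ₃ y :* (con (+ 1) :- (y :+ y :+ con (+ 1)) :* v) :+ (:Φ₃ y :* v) :* (:Φ₃ y :* v)) refl

        -- The solver evaluates constants with the optimised _×′_, ResidueChar uses _×_.
        D²+3≈4Φ₃ : D * D + 3 ×′ 1# ≈ 4 ×′ 1# * F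
        D²+3≈4Φ₃ = solve 1 (λ y → (y :+ y :+ con (+ 1)) :* (y :+ y :+ con (+ 1)) :+ con (+ 3)
                                   := con (+ 4) :* :Φ₃ y) refl y

        D∉M : D ∉ M
        D∉M D∈M = 3∉M (resp (sym (×ᵤ≈× 3 1#))
                            (+-cancelˡ (*-closed D D∈M) (resp (sym D²+3≈4Φ₃) (*-closed _ Φ₃y∈M))))

        v : Carrier
        v = proj₁ (units D D∉M)

        Dv≈1 : D * v ≈ 1#
        Dv≈1 = proj₂ (units D D∉M)

      Φ₃-approx-step : ∀ {e k} → e ∈ M → (∃₂ λ y r → Φ₃ y ≈ e ^ suc k * r) →
                       ∃₂ λ y r → Φ₃ y ≈ e ^ suc (suc k) * r
      Φ₃-approx-step {e} {k} e∈M (y , r , Φ₃y≈eᵏ⁺¹r) =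
        let v , Φ₃y′≈[Φ₃y*v]² =
              Φ₃-newton-step (resp (sym Φ₃y≈eᵏ⁺¹r) (*-closedʳ r (*-closedʳ (e ^ k) e∈M)))
        in y - Φ₃ y * v , e ^ k * r * r * v * v , (begin
          Φ₃ (y - Φ₃ y * v)
            ≈⟨ Φ₃y′≈[Φ₃y*v]² ⟩
          (Φ₃ y * v) * (Φ₃ y * v)
            ≈⟨ *-cong (*-congʳ Φ₃y≈eᵏ⁺¹r) (*-congʳ Φ₃y≈eᵏ⁺¹r) ⟩
          ((e * e ^ k) * r * v) * ((e * e ^ k) * r * v)
            ≈⟨ regroup e (e ^ k) r v ⟩
          (e * (e * e ^ k)) * (e ^ k * r * r * v * v) ∎)
        where
        regroup : ∀ e E r v →
          ((e * E) * r * v) * ((e * E) * r * v) ≈ (e * (e * E)) * (E * r * r * v * v)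
        regroup = solve 4 (λ e E r v → ((e :* E) :* r :* v) :* ((e :* E) :* r :* v)
                                       := (e :* (e :* E)) :* (E :* r :* r :* v :* v)) refl

      Φ₃-approx : ∀ {x} → Φ₃ x ∈ M → ∀ k → ∃₂ λ y r → Φ₃ y ≈ Φ₃ x ^ suc k * r
      Φ₃-approx {x} _   zero    =
        x , 1# , sym (trans (*-identityʳ (Φ₃ x * 1#)) (*-identityʳ (Φ₃ x)))
      Φ₃-approx {x} e∈M (suc k) = Φ₃-approx-step {Φ₃ x} {k} e∈M (Φ₃-approx e∈M k)

      Φ₃-hensel : Finite R → ∀ {x} → Φ₃ x ∈ M → ∃ λ ω → Φ₃ ω ≈ 0#
      Φ₃-hensel finite {x} Φ₃x∈M =
        let n , eⁿ≈0         = ∈⇒nilpotent finite Φ₃x∈M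
            y , r , Φ₃y≈eⁿ⁺¹r = Φ₃-approx Φ₃x∈M n
        in y , (begin
          Φ₃ y                      ≈⟨ Φ₃y≈eⁿ⁺¹r ⟩
          (Φ₃ x * Φ₃ x ^ n) * r     ≈⟨ *-congʳ (trans (*-congˡ eⁿ≈0) (zeroʳ (Φ₃ x))) ⟩
          0# * r                    ≈⟨ zeroˡ r ⟩
          0#                        ∎)

    -- Finiteness makes the existence of a root decidable, so it suffices to refute its absence.
    Φ₃-has-root : Finite R → ∀ n → let p = suc (suc n ℕ.* 3) in
                  Prime p → ResidueChar R M p → ∃ λ ω → Φ₃ ω ≈ 0#
    Φ₃-has-root finite n p-prime char@(p∈M , n∉M)
      with exists? finite (λ x≈y → trans (Φ₃-cong (sym x≈y))) (λ x → proj₁ finite (Φ₃ x) 0#)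
    ... | yes root = root
    ... | no ¬root = contradiction all-roots
                       (¬all-roots-of-X^[1+n]-1 char (ℕP.n<1+n k) (ℕP.m<m*n (suc n) 3 (s≤s (s≤s z≤n))))
      where
      k : ℕ
      k = suc n ℕ.* 3
      open Frobenius ideal p-prime p∈M using (fermat)

      3∉M : 3 × 1# ∉ M
      3∉M = n∉M 3 (s≤s z≤n) (s≤s (s≤s (s≤s (s≤s z≤n))))

      all-roots : ∀ a → a < k → ((suc a × 1#) ^ suc n - 1#) ∈ M
      all-roots a a<k = ∉⇒*-cancelˡ Φ₃X∉M (resp (x^3-1≈Φ₃[x]*[x-1] X) X³-1∈M)
        where
        A X : Carrier
        A = suc a × 1#
        X = A ^ suc n

        a*y-a≈a*[y-1] : ∀ a y → a * y - a ≈ a * (y - 1#)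
        a*y-a≈a*[y-1] = solve 2 (λ a y → a :* y :- a := a :* (y :- con (+ 1))) refl

        Aᵏ-1∈M : (A ^ k - 1#) ∈ M
        Aᵏ-1∈M = ∉⇒*-cancelˡ (n∉M (suc a) (s≤s z≤n) (s≤s a<k))
          (resp (a*y-a≈a*[y-1] A (A ^ k)) (fermat (suc a)))

        X³-1∈M : (X ^ 3 - 1#) ∈ M
        X³-1∈M = resp (+-congʳ (sym (^-assocʳ A (suc n) 3))) Aᵏ-1∈M

        Φ₃X∉M : Φ₃ X ∉ M
        Φ₃X∉M Φ₃X∈M = ¬root (Φ₃-hensel 3∉M finite Φ₃X∈M)

proposition4p26 : {c ℓ : Level} (p : ℕ) → Prime p → 3 ≤ p → p % 3 ≡ 1 →
    (R : CommutativeRing c ℓ) → Finite R →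
    (M : Pred (CommutativeRing.Carrier R) (c Level.⊔ ℓ)) → IsLocalWith R M →
    ResidueChar R M p →
    PthPowerUnit R p (CommutativeRing.-_ R (CommutativeRing.1# R)) →
    Connected R p →
    HasTriangle R p
proposition4p26 p p-prime 3≤p p%3≡1 R finite M isLocal char -1-power _
  with %3≡1⇒≡1+[1+n]*3 3≤p p%3≡1
... | n , ≡.refl =
  triangle-from-Φ₃-root R 1#≉0# {suc n} -1-power (proj₂ (Φ₃-has-root finite n p-prime char))
  where open LocalRing R isLocal
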